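{- Let $d \ge 3$ be odd, $k$ even, $\ell \le d$ odd, and $n = k^{\ell-1}$. Let $T$ be the $d\times k^\ell$ table whose $i$-th row $T_i$ is $$T_i = \begin{cases} \big(1^{k^{\ell-i}}\,2^{k^{\ell-i}}\cdots k^{k^{\ell-i}}\big) \text{ repeated } k^{i-1} \text{ times}, & i<\ell,\\ (1\,2\,\cdots\,k) \text{ repeated } k^{\ell-1}\text{ times}, & i \ge \ell,\end{cases}$$ where $j^{m}$ denotes $m$ consecutive copies of $j$. Then $\Delta_T(I_n) = AT_\ell(k)$. In particular, if $AT_\ell(k)\neq0$ then $\Delta_T$ is a nonzero $\mathrm{SL}(n)^{\times d}$-invariant homogeneous polynomial of degree $k^\ell$ on $(\mathbb{C}^n)^{\otimes d}$.
   Context: $I_n$ is the unit tensor in $(\mathbb{C}^n)^{\otimes d}$ (entries $1$ when all indices coincide, $0$ otherwise). For a $d\times M$ table $T$ each of whose rows contains each element of $[M/n]$ exactly $n$ times and $\sigma:[M]\to[n]$, $\mathrm{sgn}_{T_i}(\sigma):=\prod_b\mathrm{sgn}(\sigma(j_{b,1}),\ldots,\sigma(j_{b,n}))$ over values $b$, with $j_{b,1}<\cdots<j_{b,n}$ the positions where row $i$ equals $b$, and the sign of a sequence being its permutation sign if it is a permutation of $[n]$ and $0$ otherwise; $\Delta_T(X):=\sum_{\sigma_1,\ldots,\sigma_d:[M]\to[n]}\prod_i\mathrm{sgn}_{T_i}(\sigma_i)\prod_{j=1}^MX_{\sigma_1(j),\ldots,\sigma_d(j)}$. An $\ell$-dimensional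 Latin hypercube of length $k$ is a function $C:[k]^\ell\to[k^{\ell-1}]$ such that for every slice (set of cells of $[k]^\ell$ with a fixed coordinate in some direction), the values of $C$ on the slice, read in lexicographic order of cells, form a permutation of $[k^{\ell-1}]$; $\mathrm{sgn}(C)$ is the product of the signs of these permutations over all $\ell k$ slices; $AT_\ell(k):=\sum_C\mathrm{sgn}(C)$. -}

module Defs where

open import Data.Nat as ℕ using (ℕ; zero; suc; _∸_; _≤_; NonZero; _⊓_; _≡ᵇ_)
open import Data.Nat.DivMod using (_mod_)
open import Data.Nat.Properties using (m^n≢0)
open import Data.Integer as ℤ using (ℤ; -[1+_])
open import Data.Fin using (Fin; zero; suc; toℕ; _<?_)
open import Data.Fin.Properties using (_≟_)
open import Data.List using (List; []; _∷_; map; filterᵇ; length; concatMap; foldr)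
open import Data.Bool using (Bool; true; false; if_then_else_; _∧_; not)
open import Data.Product using (∃; _×_)
open import Relation.Binary.PropositionalEquality using (_≡_)
open import Relation.Nullary.Decidable using (⌊_⌋)

Even : ℕ → Set
Even k = ∃ λ m → k ≡ 2 ℕ.* m

Odd : ℕ → Set
Odd k = ∃ λ m → k ≡ suc (2 ℕ.* m)

all : {A : Set} → (A → Bool) → List A → Bool
all p [] = true
all p (x ∷ xs) = p x ∧ all p xs

allFin : (n : ℕ) → List (Fin n)
allFin zero = []
allFin (suc n) = zero ∷ map suc (allFin n)

sumFin : (n : ℕ) → (Fin n → ℤ) → ℤ
sumFin n f = foldr (λ i acc → f i ℤ.+ acc) (ℤ.+ 0) (allFin n)

prodFin : (n : ℕ) → (Fin n → ℤ) → ℤ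
prodFin n f = foldr (λ i acc → f i ℤ.* acc) (ℤ.+ 1) (allFin n)

-- Given a "sum over all elements of A" operator, sum over all functions Fin m → A.
sumFunGen : (m : ℕ) {A : Set} → ((A → ℤ) → ℤ) → ((Fin m → A) → ℤ) → ℤ
sumFunGen zero sumA f = f (λ ())
sumFunGen (suc m) sumA f =
  sumA (λ a → sumFunGen m sumA (λ g → f (λ { zero → a ; (suc i) → g i })))

sumFun : (m n : ℕ) → ((Fin m → Fin n) → ℤ) → ℤ
sumFun m n = sumFunGen m (sumFin n)

-- Sum over all functions (Fin ℓ → Fin k) → A  (functions on the cells of [k]^ℓ).
sumCellFun : (ℓ k : ℕ) {A : Set} → ((A → ℤ) → ℤ) → (((Fin ℓ → Fin k) → A) → ℤ) → ℤ
sumCellFun zero k sumA f = sumA (λ a → f (λ _ → a))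
sumCellFun (suc ℓ) k sumA f =
  sumFunGen k (sumCellFun ℓ k sumA) (λ g → f (λ c → g (c zero) (λ i → c (suc i))))

-- Sign of a sequence: its permutation sign if it is a permutation of [n],
-- and 0 otherwise.  Permutation sign = (-1)^(number of inversions).

noDup : {n : ℕ} → List (Fin n) → Bool
noDup [] = true
noDup (x ∷ xs) = all (λ y → not ⌊ x ≟ y ⌋) xs ∧ noDup xs

inversions : {n : ℕ} → List (Fin n) → ℕ
inversions [] = 0
inversions (x ∷ xs) = length (filterᵇ (λ y → ⌊ y <? x ⌋) xs) ℕ.+ inversions xs

isPermSeq : (n : ℕ) → List (Fin n) → Bool
isPermSeq n xs = (length xs ≡ᵇ n) ∧ noDup xs

seqSign : (n : ℕ) → List (Fin n) → ℤ
seqSign n xs = if isPermSeq n xs then (-[1+ 0 ]) ℤ.^ inversions xs else ℤ.+ 0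

-- Δ_T for a table T with d rows, M columns, values in [K] (K = M/n).

-- sgn_{T_i}(σ): product over values b of the sign of (σ(j_{b,1}),…,σ(j_{b,n})),
-- j_{b,1} < … < j_{b,n} the positions where the row equals b.
rowSign : {M K : ℕ} (n : ℕ) → (Fin M → Fin K) → (Fin M → Fin n) → ℤ
rowSign {M} {K} n r σ =
  prodFin K (λ b → seqSign n (map σ (filterᵇ (λ j → ⌊ r j ≟ b ⌋) (allFin M))))

Delta : (d M K n : ℕ) → (Fin d → Fin M → Fin K) → ((Fin d → Fin n) → ℤ) → ℤ
Delta d M K n T X =
  sumFunGen d (sumFun M n) (λ σ →
    prodFin d (λ i → rowSign n (T i) (σ i)) ℤ.* prodFin M (λ j → X (λ i → σ i j)))

unitTensor : (d n : ℕ) → (Fin d → Fin n) → ℤ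
unitTensor d n x =
  if all (λ i → all (λ j → ⌊ x i ≟ x j ⌋) (allFin d)) (allFin d) then ℤ.+ 1 else ℤ.+ 0

-- The table of Proposition 7.8 (0-indexed positions and values).
-- Row i (0-indexed; the paper's row i+1) at position p is
--   (p / k^(ℓ - min(i+1, ℓ))) mod k,
-- i.e. for i+1 < ℓ the row is (1^{k^{ℓ-i-1}} ⋯ k^{k^{ℓ-i-1}}) repeated, and
-- for i+1 ≥ ℓ it is (1 2 ⋯ k) repeated.
table : (d k ℓ : ℕ) .{{_ : NonZero k}} → Fin d → Fin (k ℕ.^ ℓ) → Fin k
table d k ℓ i p =
  ((toℕ p ℕ./ (k ℕ.^ (ℓ ∸ (suc (toℕ i) ⊓ ℓ)))) {{m^n≢0 k (ℓ ∸ (suc (toℕ i) ⊓ ℓ))}}) mod k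

-- cells of [k]^ℓ in lexicographic order (coordinate 0 most significant)
cells : (ℓ k : ℕ) → List (Fin ℓ → Fin k)
cells zero k = (λ ()) ∷ []
cells (suc ℓ) k =
  concatMap (λ a → map (λ c → λ { zero → a ; (suc i) → c i }) (cells ℓ k)) (allFin k)

slice : {ℓ k m : ℕ} → ((Fin ℓ → Fin k) → Fin m) → Fin ℓ → Fin k → List (Fin m)
slice {ℓ} {k} C a v = map C (filterᵇ (λ c → ⌊ c a ≟ v ⌋) (cells ℓ k))

isLatin : (ℓ k : ℕ) → ((Fin ℓ → Fin k) → Fin (k ℕ.^ (ℓ ∸ 1))) → Bool
isLatin ℓ k C =
  all (λ a → all (λ v → isPermSeq (k ℕ.^ (ℓ ∸ 1)) (slice C a v)) (allFin k)) (allFin ℓ)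

latinSign : (ℓ k : ℕ) → ((Fin ℓ → Fin k) → Fin (k ℕ.^ (ℓ ∸ 1))) → ℤ
latinSign ℓ k C =
  prodFin ℓ (λ a → prodFin k (λ v → seqSign (k ℕ.^ (ℓ ∸ 1)) (slice C a v)))

AT : (ℓ k : ℕ) → ℤ
AT ℓ k = sumCellFun ℓ k (sumFin (k ℕ.^ (ℓ ∸ 1)))
  (λ C → if isLatin ℓ k C then latinSign ℓ k C else ℤ.+ 0)

module Submission where

-- Since I_n vanishes off the diagonal, only σ with σ_1 = ⋯ = σ_d = τ contribute, so
-- Δ_T(I_n) is the sum over τ : [k^ℓ] → [n] of Π_i sgn_{T_i}(τ).  Identify positions with
-- cells of [k]^ℓ by their base-k digits (funToFin, lexicographic order).  For i ≤ ℓ the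
-- row T_i records the i-th coordinate of the cell, so sgn_{T_i}(τ) is the product of the
-- signs of the slices of C = τ ∘ funToFin in direction i, and Π_{i≤ℓ} sgn_{T_i}(τ) = sgn(C).
-- The rows T_i with i > ℓ repeat T_ℓ; there are an even number d − ℓ of them, and an odd
-- power of a sign in {0, ±1} is the sign itself, so they change nothing.  Finally sgn(C)
-- vanishes unless C is Latin, so summing over τ, i.e. over C, gives AT_ℓ(k).

open import Defs
open import Data.Bool using (Bool; true; false; if_then_else_; _∧_; T)
open import Data.Bool.Properties using (T-∧)
open import Data.Empty using (⊥-elim)
open import Data.Fin using (Fin; zero; suc; toℕ; combine; funToFin; _↑ˡ_; _↑ʳ_; splitAt)
open import Data.Fin.Properties using (_≟_; suc-injective; toℕ-injective; toℕ-fromℕ<; toℕ-combine; toℕ<n)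
open import Data.Integer using (ℤ; 0ℤ; 1ℤ; -1ℤ) renaming (_+_ to _+ℤ_; _*_ to _*ℤ_; _^_ to _^ℤ_)
import Data.Integer.Properties as ℤₚ
open import Data.List using ([]; _∷_; map; filterᵇ; concatMap; _++_)
open import Data.List.Properties using (map-id; foldr-map; foldr-cong; map-cong; map-∘; map-++; map-concatMap; concatMap-map; concatMap-cong)
open import Data.Nat using (ℕ; zero; suc; _+_; _*_; _^_; _∸_; _≤_; _⊓_; NonZero; s≤s)
open import Data.Nat.DivMod using (_/_; _%_; _mod_; %-remove-+ˡ; +-distrib-/-∣ˡ; m*n/n≡m; m<n⇒m/n≡0; m<n⇒m%n≡m)
open import Data.Nat.Divisibility using (n∣m*n)
open import Data.Nat.Tactic.RingSolver using (solve-∀)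
import Data.Nat.Properties as ℕₚ
open import Data.Product using (∃; _,_; proj₁; proj₂)
open import Data.Sum.Properties using ([,]-map)
open import Data.Vec.Functional as Vector using (Vector)
open import Data.Vec.Functional.Properties using (lookup-++ˡ; lookup-++ʳ)
open import Data.Vec.Functional.Relation.Binary.Pointwise using (Pointwise)
open import Level using (0ℓ)
open import Function using (_∘_; const; Equivalence)
open import Relation.Binary.Core using (Rel; _Preserves_⟶_)
open import Relation.Binary.Definitions using (Reflexive)
open import Relation.Binary.PropositionalEquality
open import Relation.Nullary using (¬_; yes; no)
open import Relation.Nullary.Decidable using (⌊_⌋; toWitness; fromWitness)

open ≡-Reasoning

sumFin-suc : ∀ n (f : Fin (suc n) → ℤ) → sumFin (suc n) f ≡ f zero +ℤ sumFin n (f ∘ suc)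
sumFin-suc n f = cong (f zero +ℤ_) (foldr-map _ suc 0ℤ (allFin n))

prodFin-suc : ∀ n (f : Fin (suc n) → ℤ) → prodFin (suc n) f ≡ f zero *ℤ prodFin n (f ∘ suc)
prodFin-suc n f = cong (f zero *ℤ_) (foldr-map _ suc 1ℤ (allFin n))

sumFin-cong : ∀ n → sumFin n Preserves _≗_ ⟶ _≡_
sumFin-cong n f≗g = foldr-cong (λ i _ → cong (_+ℤ _) (f≗g i)) refl (allFin n)

prodFin-cong : ∀ n → prodFin n Preserves _≗_ ⟶ _≡_
prodFin-cong n f≗g = foldr-cong (λ i _ → cong (_*ℤ _) (f≗g i)) refl (allFin n)

sumFin-zero : ∀ n {f : Fin n → ℤ} → (∀ i → f i ≡ 0ℤ) → sumFin n f ≡ 0ℤ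
sumFin-zero zero    f≡0 = refl
sumFin-zero (suc n) {f} f≡0 = begin
  sumFin (suc n) f             ≡⟨ sumFin-suc n f ⟩
  f zero +ℤ sumFin n (f ∘ suc) ≡⟨ cong₂ _+ℤ_ (f≡0 zero) (sumFin-zero n (f≡0 ∘ suc)) ⟩
  0ℤ                           ∎

prodFin-one : ∀ n {f : Fin n → ℤ} → (∀ i → f i ≡ 1ℤ) → prodFin n f ≡ 1ℤ
prodFin-one zero    f≡1 = refl
prodFin-one (suc n) {f} f≡1 = begin
  prodFin (suc n) f             ≡⟨ prodFin-suc n f ⟩
  f zero *ℤ prodFin n (f ∘ suc) ≡⟨ cong₂ _*ℤ_ (f≡1 zero) (prodFin-one n (f≡1 ∘ suc)) ⟩
  1ℤ                            ∎

prodFin-zero : ∀ n (f : Fin n → ℤ) i → f i ≡ 0ℤ → prodFin n f ≡ 0ℤ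
prodFin-zero (suc n) f zero    fi≡0 = trans (prodFin-suc n f) (cong (_*ℤ prodFin n (f ∘ suc)) fi≡0)
prodFin-zero (suc n) f (suc i) fi≡0 = begin
  prodFin (suc n) f             ≡⟨ prodFin-suc n f ⟩
  f zero *ℤ prodFin n (f ∘ suc) ≡⟨ cong (f zero *ℤ_) (prodFin-zero n (f ∘ suc) i fi≡0) ⟩
  f zero *ℤ 0ℤ                  ≡⟨ ℤₚ.*-zeroʳ (f zero) ⟩
  0ℤ                            ∎

all-map-suc : ∀ {n} (p : Fin (suc n) → Bool) xs → all p (map suc xs) ≡ all (p ∘ suc) xs
all-map-suc p []       = refl
all-map-suc p (x ∷ xs) = cong (p (suc x) ∧_) (all-map-suc p xs)

all-allFin⁻ : ∀ n {p : Fin n → Bool} → T (all p (allFin n)) → ∀ i → T (p i)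
all-allFin⁻ (suc n) {p} all-p zero    = proj₁ (Equivalence.to (T-∧ {p zero}) all-p)
all-allFin⁻ (suc n) {p} all-p (suc i) = all-allFin⁻ n
  (subst T (all-map-suc p (allFin n)) (proj₂ (Equivalence.to (T-∧ {p zero}) all-p))) i

all-allFin⁺ : ∀ n {p : Fin n → Bool} → (∀ i → T (p i)) → T (all p (allFin n))
all-allFin⁺ zero    p-all = _
all-allFin⁺ (suc n) {p} p-all = Equivalence.from (T-∧ {p zero})
  (p-all zero , subst T (sym (all-map-suc p (allFin n))) (all-allFin⁺ n (p-all ∘ suc)))

prodFin-if : ∀ n (b : Fin n → Bool) (t : Fin n → ℤ) →
  prodFin n (λ i → if b i then t i else 0ℤ) ≡ (if all b (allFin n) then prodFin n t else 0ℤ)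
prodFin-if zero b t = refl
prodFin-if (suc n) b t
  rewrite prodFin-suc n (λ i → if b i then t i else 0ℤ) | prodFin-if n (b ∘ suc) (t ∘ suc)
        | all-map-suc b (allFin n) | prodFin-suc n t
  with b zero | all (b ∘ suc) (allFin n)
... | true  | true  = refl
... | true  | false = ℤₚ.*-zeroʳ (t zero)
... | false | _     = refl

unitTensor-diagonal : ∀ d n (x : Fin d → Fin n) → (∀ i j → x i ≡ x j) → unitTensor d n x ≡ 1ℤ
unitTensor-diagonal d n x diagonal with all (λ i → all (λ j → ⌊ x i ≟ x j ⌋) (allFin d)) (allFin d) in eq
... | true  = refl
... | false = ⊥-elim (subst T eq (all-allFin⁺ d (λ i → all-allFin⁺ d (λ j → fromWitness (diagonal i j)))))

unitTensor≢0⇒diagonal : ∀ d n (x : Fin d → Fin n) → unitTensor d n x ≢ 0ℤ → ∀ i j → x i ≡ x j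
unitTensor≢0⇒diagonal d n x ≢0 i j with all (λ i → all (λ j → ⌊ x i ≟ x j ⌋) (allFin d)) (allFin d) in eq
... | true  = toWitness (all-allFin⁻ d (all-allFin⁻ d (subst T (sym eq) _) i) j)
... | false = ⊥-elim (≢0 refl)

sumFunGen-cong : ∀ m {A : Set} {S : (A → ℤ) → ℤ} → S Preserves _≗_ ⟶ _≡_ →
  sumFunGen m S Preserves _≗_ ⟶ _≡_
sumFunGen-cong zero    S-cong f≗g = f≗g _
sumFunGen-cong (suc m) S-cong f≗g = S-cong (λ a → sumFunGen-cong m S-cong (λ t → f≗g _))

sumFun-cong : ∀ m n → sumFun m n Preserves _≗_ ⟶ _≡_
sumFun-cong m n = sumFunGen-cong m (sumFin-cong n)

-- Up to an equivalence _≈_, since summation variables of function type can only be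
-- compared pointwise.
Sifts : {A : Set} → Rel A 0ℓ → ((A → ℤ) → ℤ) → Set
Sifts {A} _≈_ S = ∀ (a₀ : A) {v} f → (∀ a → ¬ a ≈ a₀ → f a ≡ 0ℤ) → (∀ a → a ≈ a₀ → f a ≡ v) → S f ≡ v

sumFin-sifts : ∀ n → Sifts _≡_ (sumFin n)
sumFin-sifts (suc n) zero {v} f off on = begin
  sumFin (suc n) f             ≡⟨ sumFin-suc n f ⟩
  f zero +ℤ sumFin n (f ∘ suc) ≡⟨ cong₂ _+ℤ_ (on zero refl) (sumFin-zero n (λ i → off (suc i) λ ())) ⟩
  v +ℤ 0ℤ                      ≡⟨ ℤₚ.+-identityʳ v ⟩
  v                            ∎
sumFin-sifts (suc n) (suc a₀) {v} f off on = begin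
  sumFin (suc n) f             ≡⟨ sumFin-suc n f ⟩
  f zero +ℤ sumFin n (f ∘ suc) ≡⟨ cong₂ _+ℤ_ (off zero λ ())
                                    (sumFin-sifts n a₀ (f ∘ suc) (λ a a≢a₀ → off (suc a) (a≢a₀ ∘ suc-injective))
                                                                 (λ a a≡a₀ → on (suc a) (cong suc a≡a₀))) ⟩
  0ℤ +ℤ v                      ≡⟨ ℤₚ.+-identityˡ v ⟩
  v                            ∎

sumFunGen-sifts : ∀ m {A : Set} {_≈_ : Rel A 0ℓ} {S} → Sifts _≈_ S → Sifts (Pointwise _≈_ {m}) (sumFunGen m S)
sumFunGen-sifts zero    S-sifts a₀ f off on = on _ (λ ())
sumFunGen-sifts (suc m) S-sifts a₀ f off on =
  S-sifts (a₀ zero) _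
    (λ a a≉ → sumFunGen-sifts m S-sifts (a₀ ∘ suc) _ (λ t _ → off _ (λ eq → a≉ (eq zero)))
                                                     (λ t _ → off _ (λ eq → a≉ (eq zero))))
    (λ a a≈ → sumFunGen-sifts m S-sifts (a₀ ∘ suc) _ (λ t t≉ → off _ (λ eq → t≉ (eq ∘ suc)))
                                                     (λ t t≈ → on _ λ { zero → a≈ ; (suc i) → t≈ i }))

rowSign-cong : ∀ {M K} n (r : Fin M → Fin K) → rowSign n r Preserves _≗_ ⟶ _≡_
rowSign-cong {M} {K} n r σ≗τ =
  prodFin-cong K (λ b → cong (seqSign n) (map-cong σ≗τ (filterᵇ (λ j → ⌊ r j ≟ b ⌋) (allFin M))))

Delta-unitTensor : ∀ d M K n (T : Fin (suc d) → Fin M → Fin K) →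
  Delta (suc d) M K n T (unitTensor (suc d) n) ≡ sumFun M n (λ τ → prodFin (suc d) (λ i → rowSign n (T i) τ))
Delta-unitTensor d M K n T = sumFun-cong M n λ τ →
  sumFunGen-sifts d (sumFunGen-sifts M (sumFin-sifts n)) (const τ) _ (λ _ → off _) (λ _ → on _)
  where
  column : (Fin (suc d) → Fin M → Fin n) → Fin M → ℤ
  column σ j = unitTensor (suc d) n (λ i → σ i j)

  rows columns : (Fin (suc d) → Fin M → Fin n) → ℤ
  rows σ    = prodFin (suc d) (λ i → rowSign n (T i) (σ i))
  columns σ = prodFin M (column σ)

  off : ∀ σ → ¬ Pointwise _≗_ (σ ∘ suc) (const (σ zero)) → rows σ *ℤ columns σ ≡ 0ℤ
  off σ σ≉σ₀ with columns σ ℤₚ.≟ 0ℤ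
  ... | yes ≡0 = trans (cong (rows σ *ℤ_) ≡0) (ℤₚ.*-zeroʳ (rows σ))
  ... | no  ≢0 = ⊥-elim (σ≉σ₀ λ i j → diagonal j (suc i) zero)
    where
    diagonal : ∀ j i i′ → σ i j ≡ σ i′ j
    diagonal j = unitTensor≢0⇒diagonal (suc d) n (λ i → σ i j) (≢0 ∘ prodFin-zero M (column σ) j)

  on : ∀ σ → Pointwise _≗_ (σ ∘ suc) (const (σ zero)) →
    rows σ *ℤ columns σ ≡ prodFin (suc d) (λ i → rowSign n (T i) (σ zero))
  on σ σ≈σ₀ = begin
    rows σ *ℤ columns σ ≡⟨ cong₂ _*ℤ_ rows≡ columns≡1 ⟩
    rows₀ *ℤ 1ℤ         ≡⟨ ℤₚ.*-identityʳ rows₀ ⟩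
    rows₀               ∎
    where
    rows₀ = prodFin (suc d) (λ i → rowSign n (T i) (σ zero))
    σ≗σ₀ : ∀ i → σ i ≗ σ zero
    σ≗σ₀ zero    _ = refl
    σ≗σ₀ (suc i)   = σ≈σ₀ i
    rows≡ : rows σ ≡ rows₀
    rows≡ = prodFin-cong (suc d) (λ i → rowSign-cong n (T i) (σ≗σ₀ i))
    columns≡1 : columns σ ≡ 1ℤ
    columns≡1 = prodFin-one M λ j →
      unitTensor-diagonal (suc d) n (λ i → σ i j) (λ i i′ → trans (σ≗σ₀ i j) (sym (σ≗σ₀ i′ j)))

sumFunGen-++ : ∀ m p {A : Set} {S : (A → ℤ) → ℤ} → S Preserves _≗_ ⟶ _≡_ →
  (h : Vector A (m + p) → ℤ) → h Preserves _≗_ ⟶ _≡_ →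
  sumFunGen (m + p) S h ≡ sumFunGen m S (λ t → sumFunGen p S (λ u → h (t Vector.++ u)))
sumFunGen-++ zero    p S-cong h h-cong = refl
sumFunGen-++ (suc m) p S-cong h h-cong = S-cong λ a → trans
  (sumFunGen-++ m p S-cong _ (λ g≗g′ → h-cong λ { zero → refl ; (suc i) → g≗g′ i }))
  (sumFunGen-cong m S-cong λ t → sumFunGen-cong p S-cong λ u →
    h-cong λ { zero → refl ; (suc i) → sym ([,]-map (splitAt m i)) })

sumFunGen-combine : ∀ k m {A : Set} {S : (A → ℤ) → ℤ} → S Preserves _≗_ ⟶ _≡_ →
  (f : Vector (Vector A m) k → ℤ) → f Preserves Pointwise _≗_ ⟶ _≡_ →
  sumFunGen k (sumFunGen m S) f ≡ sumFunGen (k * m) S (λ τ → f (λ a b → τ (combine a b)))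
sumFunGen-combine zero    m S-cong f f-cong = f-cong (λ ())
sumFunGen-combine (suc k) m S-cong f f-cong = trans
  (sumFunGen-cong m S-cong λ t → sumFunGen-combine k m S-cong _
    (λ g≈g′ → f-cong λ { zero _ → refl ; (suc a) → g≈g′ a }))
  (sym (trans
    (sumFunGen-++ m (k * m) S-cong _ (λ τ≗τ′ → f-cong (λ a b → τ≗τ′ (combine a b))))
    (sumFunGen-cong m S-cong λ t → sumFunGen-cong (k * m) S-cong λ u →
      f-cong λ { zero b → lookup-++ˡ t u b ; (suc a) b → lookup-++ʳ t u (combine a b) })))

sumFunGen-reindex : ∀ k {A B : Set} {_≈_ : Rel A 0ℓ} → Reflexive _≈_ →
  {sumA : (A → ℤ) → ℤ} → sumA Preserves _≗_ ⟶ _≡_ →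
  {sumB : (B → ℤ) → ℤ} → sumB Preserves _≗_ ⟶ _≡_ →
  (φ : B → A) → (∀ h → h Preserves _≈_ ⟶ _≡_ → sumA h ≡ sumB (h ∘ φ)) →
  (f : Vector A k → ℤ) → f Preserves Pointwise _≈_ ⟶ _≡_ →
  sumFunGen k sumA f ≡ sumFunGen k sumB (λ g → f (φ ∘ g))
sumFunGen-reindex zero    ≈-refl sumA-cong sumB-cong φ reindex f f-cong = f-cong (λ ())
sumFunGen-reindex (suc k) ≈-refl sumA-cong sumB-cong φ reindex f f-cong = trans
  (sumA-cong λ a → sumFunGen-reindex k ≈-refl sumA-cong sumB-cong φ reindex _
    (λ g≈g′ → f-cong λ { zero → ≈-refl ; (suc i) → g≈g′ i }))
  (trans
    (reindex _ (λ a≈a′ → sumFunGen-cong k sumB-cong λ g → f-cong λ { zero → a≈a′ ; (suc i) → ≈-refl }))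
    (sumB-cong λ b → sumFunGen-cong k sumB-cong λ g → f-cong λ { zero → ≈-refl ; (suc i) → ≈-refl }))

sumCellFun-cong : ∀ ℓ k {A : Set} {S : (A → ℤ) → ℤ} → S Preserves _≗_ ⟶ _≡_ →
  sumCellFun ℓ k S Preserves _≗_ ⟶ _≡_
sumCellFun-cong zero    k S-cong F≗G = S-cong (λ a → F≗G _)
sumCellFun-cong (suc ℓ) k S-cong F≗G =
  sumFunGen-cong k (sumCellFun-cong ℓ k S-cong) (λ g → F≗G _)

sumCellFun≡sumFun∘funToFin : ∀ ℓ k n (F : ((Fin ℓ → Fin k) → Fin n) → ℤ) → F Preserves _≗_ ⟶ _≡_ →
  sumCellFun ℓ k (sumFin n) F ≡ sumFun (k ^ ℓ) n (λ τ → F (τ ∘ funToFin))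
sumCellFun≡sumFun∘funToFin zero    k n F F-cong = refl
sumCellFun≡sumFun∘funToFin (suc ℓ) k n F F-cong = trans
  (sumFunGen-reindex k (λ _ → refl)
    (sumCellFun-cong ℓ k (sumFin-cong n)) (sumFun-cong (k ^ ℓ) n)
    (λ τ → τ ∘ funToFin) (λ G G-cong → sumCellFun≡sumFun∘funToFin ℓ k n G G-cong)
    _ (λ C≈C′ → F-cong (λ c → C≈C′ (c zero) (c ∘ suc))))
  (sumFunGen-combine k (k ^ ℓ) (sumFin-cong n) _ (λ τ≈τ′ → F-cong (λ c → τ≈τ′ _ _)))

[m*n+o]/n≡m+o/n : ∀ m o n .{{_ : NonZero n}} → (m * n + o) / n ≡ m + o / n
[m*n+o]/n≡m+o/n m o n = trans (+-distrib-/-∣ˡ o (n∣m*n m)) (cong (_+ o / n) (m*n/n≡m m n))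

[m*k*n+o]/n%k≡o/n%k : ∀ m k o n .{{_ : NonZero k}} .{{_ : NonZero n}} →
  (m * k * n + o) / n % k ≡ o / n % k
[m*k*n+o]/n%k≡o/n%k m k o n = trans
  (cong (_% k) ([m*n+o]/n≡m+o/n (m * k) o n))
  (%-remove-+ˡ (o / n) (n∣m*n m))

digit : (k : ℕ) .{{_ : NonZero k}} (e x : ℕ) → ℕ
digit k e x = (x / k ^ e) {{ℕₚ.m^n≢0 k e}} % k

digit-funToFin : ∀ {ℓ k} .{{_ : NonZero k}} (c : Fin ℓ → Fin k) a →
  digit k (ℓ ∸ suc (toℕ a)) (toℕ (funToFin c)) ≡ toℕ (c a)
digit-funToFin {suc ℓ} {k} c zero = begin
  digit k ℓ (toℕ (funToFin c))     ≡⟨ cong (digit k ℓ) (trans (toℕ-combine (c zero) _) (cong (_+ r) (ℕₚ.*-comm (k ^ ℓ) c₀))) ⟩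
  (c₀ * k ^ ℓ + r) / k ^ ℓ % k     ≡⟨ cong (_% k) ([m*n+o]/n≡m+o/n c₀ r (k ^ ℓ)) ⟩
  (c₀ + r / k ^ ℓ) % k             ≡⟨ cong (λ x → (c₀ + x) % k) (m<n⇒m/n≡0 (toℕ<n (funToFin (c ∘ suc)))) ⟩
  (c₀ + 0) % k                     ≡⟨ cong (_% k) (ℕₚ.+-identityʳ c₀) ⟩
  c₀ % k                           ≡⟨ m<n⇒m%n≡m (toℕ<n (c zero)) ⟩
  c₀                               ∎
  where
  instance _ = ℕₚ.m^n≢0 k ℓ
  c₀ = toℕ (c zero)
  r = toℕ (funToFin (c ∘ suc))
digit-funToFin {suc ℓ} {k} c (suc a) = begin
  digit k e (toℕ (funToFin c))     ≡⟨ cong (digit k e) (trans (toℕ-combine (c zero) _) (cong (_+ r) high)) ⟩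
  (m * k * k ^ e + r) / k ^ e % k  ≡⟨ [m*k*n+o]/n%k≡o/n%k m k r (k ^ e) ⟩
  digit k e r                      ≡⟨ digit-funToFin (c ∘ suc) a ⟩
  toℕ (c (suc a))                  ∎
  where
  e = ℓ ∸ suc (toℕ a)
  instance _ = ℕₚ.m^n≢0 k e
  r = toℕ (funToFin (c ∘ suc))
  m = k ^ toℕ a * toℕ (c zero)
  high : k ^ ℓ * toℕ (c zero) ≡ m * k * k ^ e
  high = begin
    k ^ ℓ * toℕ (c zero)                  ≡⟨ cong (λ x → k ^ x * toℕ (c zero)) (sym (ℕₚ.m∸n+n≡m (toℕ<n a))) ⟩
    k ^ (e + suc (toℕ a)) * toℕ (c zero)  ≡⟨ cong (_* toℕ (c zero)) (ℕₚ.^-distribˡ-+-* k e (suc (toℕ a))) ⟩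
    k ^ e * (k * k ^ toℕ a) * toℕ (c zero) ≡⟨ rearrange (k ^ e) k (k ^ toℕ a) (toℕ (c zero)) ⟩
    m * k * k ^ e                          ∎
    where
    rearrange : ∀ x y z w → x * (y * z) * w ≡ z * w * y * x
    rearrange = solve-∀

allFin-+ : ∀ m n → allFin (m + n) ≡ map (_↑ˡ n) (allFin m) ++ map (m ↑ʳ_) (allFin n)
allFin-+ zero    n = sym (map-id (allFin n))
allFin-+ (suc m) n = cong (zero ∷_) (begin
  map suc (allFin (m + n))
    ≡⟨ cong (map suc) (allFin-+ m n) ⟩
  map suc (map (_↑ˡ n) (allFin m) ++ map (m ↑ʳ_) (allFin n))
    ≡⟨ map-++ suc (map (_↑ˡ n) (allFin m)) (map (m ↑ʳ_) (allFin n)) ⟩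
  map suc (map (_↑ˡ n) (allFin m)) ++ map suc (map (m ↑ʳ_) (allFin n))
    ≡⟨ cong₂ _++_ (trans (sym (map-∘ (allFin m))) (map-∘ (allFin m))) (sym (map-∘ (allFin n))) ⟩
  map (_↑ˡ n) (map suc (allFin m)) ++ map (suc m ↑ʳ_) (allFin n)
    ∎)

allFin-combine : ∀ m n → allFin (m * n) ≡ concatMap (λ a → map (combine a) (allFin n)) (allFin m)
allFin-combine zero    n = refl
allFin-combine (suc m) n = trans (allFin-+ n (m * n)) (cong (map (_↑ˡ (m * n)) (allFin n) ++_) (begin
  map (n ↑ʳ_) (allFin (m * n))
    ≡⟨ cong (map (n ↑ʳ_)) (allFin-combine m n) ⟩
  map (n ↑ʳ_) (concatMap (λ a → map (combine a) (allFin n)) (allFin m))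
    ≡⟨ map-concatMap (n ↑ʳ_) _ (allFin m) ⟩
  concatMap (λ a → map (n ↑ʳ_) (map (combine a) (allFin n))) (allFin m)
    ≡⟨ concatMap-cong (λ a → sym (map-∘ (allFin n))) (allFin m) ⟩
  concatMap (λ a → map (combine (suc a)) (allFin n)) (allFin m)
    ≡⟨ concatMap-map _ suc (allFin m) ⟨
  concatMap (λ a → map (combine a) (allFin n)) (map suc (allFin m))
    ∎))

map-funToFin-cells : ∀ ℓ k → map funToFin (cells ℓ k) ≡ allFin (k ^ ℓ)
map-funToFin-cells zero    k = refl
map-funToFin-cells (suc ℓ) k = begin
  map funToFin (cells (suc ℓ) k)
    ≡⟨ map-concatMap funToFin _ (allFin k) ⟩
  concatMap (λ a → map funToFin (map _ (cells ℓ k))) (allFin k)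
    ≡⟨ concatMap-cong (λ a → trans (sym (map-∘ (cells ℓ k))) (map-∘ (cells ℓ k))) (allFin k) ⟩
  concatMap (λ a → map (combine a) (map funToFin (cells ℓ k))) (allFin k)
    ≡⟨ concatMap-cong (λ a → cong (map (combine a)) (map-funToFin-cells ℓ k)) (allFin k) ⟩
  concatMap (λ a → map (combine a) (allFin (k ^ ℓ))) (allFin k)
    ≡⟨ allFin-combine k (k ^ ℓ) ⟨
  allFin (k ^ suc ℓ)
    ∎

filterᵇ-map : ∀ {A B : Set} (p : B → Bool) (f : A → B) xs → filterᵇ p (map f xs) ≡ map f (filterᵇ (p ∘ f) xs)
filterᵇ-map p f []       = refl
filterᵇ-map p f (x ∷ xs) with p (f x)
... | true  = cong (f x ∷_) (filterᵇ-map p f xs)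
... | false = filterᵇ-map p f xs

filterᵇ-cong : ∀ {A : Set} {p q : A → Bool} → p ≗ q → filterᵇ p ≗ filterᵇ q
filterᵇ-cong         p≗q []       = refl
filterᵇ-cong {q = q} p≗q (x ∷ xs) rewrite p≗q x with q x
... | true  = cong (x ∷_) (filterᵇ-cong p≗q xs)
... | false = filterᵇ-cong p≗q xs

-- Row i of table d k ℓ is, by definition, digitRow k ℓ (ℓ ∸ (suc i ⊓ ℓ)).
digitRow : (k ℓ : ℕ) .{{_ : NonZero k}} → ℕ → Fin (k ^ ℓ) → Fin k
digitRow k ℓ e p = ((toℕ p / k ^ e) {{ℕₚ.m^n≢0 k e}}) mod k

digitRow-funToFin : ∀ {ℓ k} .{{_ : NonZero k}} (c : Fin ℓ → Fin k) a →
  digitRow k ℓ (ℓ ∸ suc (toℕ a)) (funToFin c) ≡ c a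
digitRow-funToFin c a = toℕ-injective (trans (toℕ-fromℕ< _) (digit-funToFin c a))

slice-∘funToFin : ∀ {ℓ k m} .{{_ : NonZero k}} (τ : Fin (k ^ ℓ) → Fin m) a v →
  slice (τ ∘ funToFin) a v ≡ map τ (filterᵇ (λ p → ⌊ digitRow k ℓ (ℓ ∸ suc (toℕ a)) p ≟ v ⌋) (allFin (k ^ ℓ)))
slice-∘funToFin {ℓ} {k} τ a v = begin
  map (τ ∘ funToFin) (filterᵇ (λ c → ⌊ c a ≟ v ⌋) (cells ℓ k))
    ≡⟨ map-∘ _ ⟩
  map τ (map funToFin (filterᵇ (λ c → ⌊ c a ≟ v ⌋) (cells ℓ k)))
    ≡⟨ cong (map τ ∘ map funToFin) (filterᵇ-cong (λ c → cong (λ x → ⌊ x ≟ v ⌋) (sym (digitRow-funToFin c a))) (cells ℓ k)) ⟩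
  map τ (map funToFin (filterᵇ (isDigit ∘ funToFin) (cells ℓ k)))
    ≡⟨ cong (map τ) (filterᵇ-map isDigit funToFin (cells ℓ k)) ⟨
  map τ (filterᵇ isDigit (map funToFin (cells ℓ k)))
    ≡⟨ cong (map τ ∘ filterᵇ isDigit) (map-funToFin-cells ℓ k) ⟩
  map τ (filterᵇ isDigit (allFin (k ^ ℓ)))
    ∎
  where
  isDigit : Fin (k ^ ℓ) → Bool
  isDigit p = ⌊ digitRow k ℓ (ℓ ∸ suc (toℕ a)) p ≟ v ⌋

latinSign-∘funToFin : ∀ ℓ k .{{_ : NonZero k}} (τ : Fin (k ^ ℓ) → Fin (k ^ (ℓ ∸ 1))) →
  latinSign ℓ k (τ ∘ funToFin) ≡ prodFin ℓ (λ a → rowSign (k ^ (ℓ ∸ 1)) (digitRow k ℓ (ℓ ∸ suc (toℕ a))) τ)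
latinSign-∘funToFin ℓ k τ =
  prodFin-cong ℓ λ a → prodFin-cong k λ v → cong (seqSign (k ^ (ℓ ∸ 1))) (slice-∘funToFin τ a v)

data IsSign : ℤ → Set where
  sign0 : IsSign 0ℤ
  sign+ : IsSign 1ℤ
  sign- : IsSign -1ℤ

IsSign-* : ∀ {x y} → IsSign x → IsSign y → IsSign (x *ℤ y)
IsSign-* sign0 _     = sign0
IsSign-* sign+ sign0 = sign0
IsSign-* sign+ sign+ = sign+
IsSign-* sign+ sign- = sign-
IsSign-* sign- sign0 = sign0
IsSign-* sign- sign+ = sign-
IsSign-* sign- sign- = sign+

IsSign-^ : ∀ {x} n → IsSign x → IsSign (x ^ℤ n)
IsSign-^ zero    _ = sign+
IsSign-^ (suc n) x = IsSign-* x (IsSign-^ n x)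

IsSign-odd-^ : ∀ {x} m → IsSign x → x ^ℤ suc (2 * m) ≡ x
IsSign-odd-^ m sign0 = refl
IsSign-odd-^ m sign+ = ℤₚ.^-zeroˡ (suc (2 * m))
IsSign-odd-^ m sign- = begin
  -1ℤ *ℤ -1ℤ ^ℤ (2 * m)     ≡⟨ cong (-1ℤ *ℤ_) (ℤₚ.^-*-assoc -1ℤ 2 m) ⟨
  -1ℤ *ℤ 1ℤ ^ℤ m            ≡⟨ cong (-1ℤ *ℤ_) (ℤₚ.^-zeroˡ m) ⟩
  -1ℤ                       ∎

prodFin-isSign : ∀ n {f : Fin n → ℤ} → (∀ i → IsSign (f i)) → IsSign (prodFin n f)
prodFin-isSign zero    _ = sign+
prodFin-isSign (suc n) {f} f-sign =
  subst IsSign (sym (prodFin-suc n f)) (IsSign-* (f-sign zero) (prodFin-isSign n (f-sign ∘ suc)))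

seqSign-isSign : ∀ n xs → IsSign (seqSign n xs)
seqSign-isSign n xs with isPermSeq n xs
... | true  = IsSign-^ (inversions xs) sign-
... | false = sign0

rowSign-isSign : ∀ {M K} n (r : Fin M → Fin K) σ → IsSign (rowSign n r σ)
rowSign-isSign {M} {K} n r σ =
  prodFin-isSign K (λ b → seqSign-isSign n (map σ (filterᵇ (λ j → ⌊ r j ≟ b ⌋) (allFin M))))

prodℕ : ℕ → (ℕ → ℤ) → ℤ
prodℕ zero    g = 1ℤ
prodℕ (suc n) g = g 0 *ℤ prodℕ n (g ∘ suc)

prodFin-toℕ : ∀ n (g : ℕ → ℤ) → prodFin n (g ∘ toℕ) ≡ prodℕ n g
prodFin-toℕ zero    g = refl
prodFin-toℕ (suc n) g = trans (prodFin-suc n (g ∘ toℕ)) (cong (g 0 *ℤ_) (prodFin-toℕ n (g ∘ suc)))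

prodℕ-cong : ∀ n {g h : ℕ → ℤ} → g ≗ h → prodℕ n g ≡ prodℕ n h
prodℕ-cong zero    g≗h = refl
prodℕ-cong (suc n) g≗h = cong₂ _*ℤ_ (g≗h 0) (prodℕ-cong n (g≗h ∘ suc))

prodℕ-const : ∀ n x → prodℕ n (const x) ≡ x ^ℤ n
prodℕ-const zero    x = refl
prodℕ-const (suc n) x = cong (x *ℤ_) (prodℕ-const n x)

prodℕ-+ : ∀ m n (g : ℕ → ℤ) → prodℕ (m + n) g ≡ prodℕ m g *ℤ prodℕ n (g ∘ (m +_))
prodℕ-+ zero    n g = sym (ℤₚ.*-identityˡ (prodℕ n g))
prodℕ-+ (suc m) n g = trans (cong (g 0 *ℤ_) (prodℕ-+ m n (g ∘ suc))) (sym (ℤₚ.*-assoc (g 0) _ _))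

prodℕ-suc : ∀ n (g : ℕ → ℤ) → prodℕ (suc n) g ≡ prodℕ n g *ℤ g n
prodℕ-suc zero    g = trans (ℤₚ.*-identityʳ (g 0)) (sym (ℤₚ.*-identityˡ (g 0)))
prodℕ-suc (suc n) g = trans (cong (g 0 *ℤ_) (prodℕ-suc n (g ∘ suc))) (sym (ℤₚ.*-assoc (g 0) _ _))

prodℕ-+-even : ∀ m q (g : ℕ → ℤ) → (∀ i → m ≤ i → g i ≡ g m) → IsSign (g m) →
  prodℕ (suc m + 2 * q) g ≡ prodℕ (suc m) g
prodℕ-+-even m q g stable g-sign = begin
  prodℕ (suc m + 2 * q) g                        ≡⟨ prodℕ-+ (suc m) (2 * q) g ⟩
  prodℕ (suc m) g *ℤ prodℕ (2 * q) (g ∘ (suc m +_))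
    ≡⟨ cong (prodℕ (suc m) g *ℤ_) (trans (prodℕ-cong (2 * q) λ i → stable _ (ℕₚ.m≤n⇒m≤1+n (ℕₚ.m≤m+n m i)))
                                          (prodℕ-const (2 * q) (g m))) ⟩
  prodℕ (suc m) g *ℤ g m ^ℤ (2 * q)              ≡⟨ cong (_*ℤ g m ^ℤ (2 * q)) (prodℕ-suc m g) ⟩
  prodℕ m g *ℤ g m *ℤ g m ^ℤ (2 * q)             ≡⟨ ℤₚ.*-assoc (prodℕ m g) (g m) (g m ^ℤ (2 * q)) ⟩
  prodℕ m g *ℤ g m ^ℤ suc (2 * q)                ≡⟨ cong (prodℕ m g *ℤ_) (IsSign-odd-^ q g-sign) ⟩
  prodℕ m g *ℤ g m                               ≡⟨ prodℕ-suc m g ⟨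
  prodℕ (suc m) g                                ∎

latinSign-cong : ∀ ℓ k → latinSign ℓ k Preserves _≗_ ⟶ _≡_
latinSign-cong ℓ k C≗C′ = prodFin-cong ℓ λ a → prodFin-cong k λ v →
  cong (seqSign (k ^ (ℓ ∸ 1))) (map-cong C≗C′ (filterᵇ (λ c → ⌊ c a ≟ v ⌋) (cells ℓ k)))

latinSign-if-isLatin : ∀ ℓ k C → latinSign ℓ k C ≡
  (if isLatin ℓ k C then prodFin ℓ (λ a → prodFin k (λ v → -1ℤ ^ℤ inversions (slice C a v))) else 0ℤ)
latinSign-if-isLatin ℓ k C = trans
  (prodFin-cong ℓ λ a → prodFin-if k (λ v → isPermSeq (k ^ (ℓ ∸ 1)) (slice C a v)) _)
  (prodFin-if ℓ _ _)

AT≡sum-latinSign : ∀ ℓ k → AT ℓ k ≡ sumCellFun ℓ k (sumFin (k ^ (ℓ ∸ 1))) (latinSign ℓ k)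
AT≡sum-latinSign ℓ k = sumCellFun-cong ℓ k (sumFin-cong (k ^ (ℓ ∸ 1))) vanishes
  where
  vanishes : ∀ C → (if isLatin ℓ k C then latinSign ℓ k C else 0ℤ) ≡ latinSign ℓ k C
  vanishes C with isLatin ℓ k C | latinSign-if-isLatin ℓ k C
  ... | true  | _           = refl
  ... | false | latinSign≡0 = sym latinSign≡0

table-rowSigns≡latinSign : ∀ q ℓ k .{{_ : NonZero k}} (τ : Fin (k ^ suc ℓ) → Fin (k ^ ℓ)) →
  prodFin (suc ℓ + 2 * q) (λ i → rowSign (k ^ ℓ) (table (suc ℓ + 2 * q) k (suc ℓ) i) τ) ≡
  latinSign (suc ℓ) k (τ ∘ funToFin)
table-rowSigns≡latinSign q ℓ k τ = begin
  prodFin (suc ℓ + 2 * q) (g ∘ toℕ)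
    ≡⟨ prodFin-toℕ (suc ℓ + 2 * q) g ⟩
  prodℕ (suc ℓ + 2 * q) g
    ≡⟨ prodℕ-+-even ℓ q g stable (row-isSign (suc ℓ ∸ (suc ℓ ⊓ suc ℓ))) ⟩
  prodℕ (suc ℓ) g
    ≡⟨ prodFin-toℕ (suc ℓ) g ⟨
  prodFin (suc ℓ) (g ∘ toℕ)
    ≡⟨ prodFin-cong (suc ℓ) (λ a → cong (row ∘ (suc ℓ ∸_)) (ℕₚ.m≤n⇒m⊓n≡m (toℕ<n a))) ⟩
  prodFin (suc ℓ) (λ a → row (suc ℓ ∸ suc (toℕ a)))
    ≡⟨ latinSign-∘funToFin (suc ℓ) k τ ⟨
  latinSign (suc ℓ) k (τ ∘ funToFin)
    ∎
  where
  row : ℕ → ℤ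
  row e = rowSign (k ^ ℓ) (digitRow k (suc ℓ) e) τ
  row-isSign : ∀ e → IsSign (row e)
  row-isSign e = rowSign-isSign (k ^ ℓ) (digitRow k (suc ℓ) e) τ
  g : ℕ → ℤ
  g i = row (suc ℓ ∸ (suc i ⊓ suc ℓ))
  stable : ∀ i → ℓ ≤ i → g i ≡ g ℓ
  stable i ℓ≤i = cong (row ∘ (suc ℓ ∸_)) (trans (ℕₚ.m≥n⇒m⊓n≡n (s≤s ℓ≤i)) (sym (ℕₚ.⊓-idem (suc ℓ))))

odd≤odd⇒+even : ∀ {m n} → Odd m → Odd n → m ≤ n → ∃ λ q → n ≡ m + 2 * q
odd≤odd⇒+even (a , refl) (b , refl) (s≤s 2a≤2b) = b ∸ a , cong suc (begin
  2 * b               ≡⟨ cong (2 *_) (ℕₚ.m+[n∸m]≡n {a} {b} (ℕₚ.*-cancelˡ-≤ 2 2a≤2b)) ⟨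
  2 * (a + (b ∸ a))   ≡⟨ ℕₚ.*-distribˡ-+ 2 a (b ∸ a) ⟩
  2 * a + 2 * (b ∸ a) ∎)

proposition7p8 : (d k ℓ : ℕ) .{{_ : NonZero k}} →
    3 ≤ d → Odd d → Even k → ℓ ≤ d → Odd ℓ →
    Delta d (k ^ ℓ) k (k ^ (ℓ ∸ 1)) (table d k ℓ) (unitTensor d (k ^ (ℓ ∸ 1))) ≡ AT ℓ k
proposition7p8 d k ℓ _ odd-d _ ℓ≤d odd-ℓ@(m , refl) with odd≤odd⇒+even odd-ℓ odd-d ℓ≤d
... | q , refl = begin
  Delta d (k ^ ℓ) k N (table d k ℓ) (unitTensor d N)
    ≡⟨ Delta-unitTensor (2 * m + 2 * q) (k ^ ℓ) k N (table d k ℓ) ⟩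
  sumFun (k ^ ℓ) N (λ τ → prodFin d (λ i → rowSign N (table d k ℓ i) τ))
    ≡⟨ sumFun-cong (k ^ ℓ) N (table-rowSigns≡latinSign q (2 * m) k) ⟩
  sumFun (k ^ ℓ) N (λ τ → latinSign ℓ k (τ ∘ funToFin))
    ≡⟨ sumCellFun≡sumFun∘funToFin ℓ k N (latinSign ℓ k) (latinSign-cong ℓ k) ⟨
  sumCellFun ℓ k (sumFin N) (latinSign ℓ k)
    ≡⟨ AT≡sum-latinSign ℓ k ⟨
  AT ℓ k
    ∎
  where
  N = k ^ (ℓ ∸ 1)
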